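{- Let $d\ge1$, $\pi\in NC(d)$ and $0\le k\le d+1$. Then $wt_k(\pi)\cdot wt_{d+1-k}(\alpha(\pi))=x^{d+1}$.
   Context: $NC(d)$ is the set of noncrossing partitions of $[1,d]$. For $\pi\in NC(d)$: a singleton is an element forming a block by itself; $\mathrm{block}(\pi)$ is the number of blocks of size at least $2$; $k\in[1,d]$ is an antisingleton if $k$ and $k+1$ lie in the same block, with $d+1$ read as $1$. For a family $\mathcal S$ of pairwise disjoint intervals of $[1,d]$: a singleton is in $\mathcal S$ if it lies in an interval of $\mathcal S$; an antisingleton $k\le d-1$ is in $\mathcal S$ if $\{k,k+1\}$ lies in a single interval of $\mathcal S$; the antisingleton $d$ is in $\mathcal S$ iff $\mathcal S$ contains a wrapped interval. Here $[k,l]=\{k,\dots,l\}$ for $k\le l$ is not wrapped, and $[1,d]^*$ denotes the whole set $[1,d]$ regarded as a wrapped interval. $wt_{\mathcal S}(\pi)=x^{\mathrm{block}(\pi)+s+a}$ with $s$ (resp. $a$) the number of singletons (resp. antisingletons) of $\pi$ in $\mathcal S$. Define $wt_k(\pi)=wt_{\{[k,d]\}}(\pi)$ for $1\le k\le d$, $wt_0(\pi)=wt_{\{[1,d]^*\}}(\pi)$, $wt_{d+1}(\pi)=wt_\emptyset(\pi)$. The Simion–Ullman involution $\alpha$: place $1,\dots,d$ clockwise on a circle, put $(d-i)'$ on the arc between $i$ and $i+1$ ($1\le i\le d-1$) and $d'$ between $d$ and $1$; $\alpha(\pi)$ is the coarsest noncrossing partition of $\{1',\dots,d'\}$ whose block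 convex hulls do not intersect those of the blocks of $\pi$, with $i'$ identified with $i$. -}

module Defs where

open import Data.Nat using (ℕ; zero; suc; _+_; _*_; _∸_; _≤ᵇ_; _≡ᵇ_)
open import Data.Bool using (Bool; true; false; if_then_else_; _∧_; _∨_; not)
open import Data.Fin as Fin using (Fin; toℕ)
open import Data.Fin.Properties using (_≟_)
open import Data.List using (List; allFin; map)
open import Data.Nat.ListAction using (sum)
open import Data.Bool.ListAction using (and; or)
open import Data.Product using (_×_)
open import Data.Sum using (_⊎_)
open import Relation.Nullary using (¬_; does)
open import Relation.Binary.PropositionalEquality using (_≡_)

-- Element i of [1,d] is represented by
-- (i : Fin d) with toℕ i = i - 1.  A partition is given by a block
-- labelling  f : Fin d → Fin d ; i and j lie in the same block iff
-- f i ≡ f j.  (Every partition of [1,d] arises this way; all notions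
-- below depend only on the induced equivalence relation.)

Part : ℕ → Set
Part d = Fin d → Fin d

NonCrossing : ∀ {d} → Part d → Set
NonCrossing {d} f = (a b c e : Fin d) → a Fin.< b → b Fin.< c → c Fin.< e →
  f a ≡ f c → f b ≡ f e → f a ≡ f b

same : ∀ {d} → Part d → Fin d → Fin d → Bool
same f i j = does (f i ≟ f j)

eqF : ∀ {d} → Fin d → Fin d → Bool
eqF i j = does (i ≟ j)

countB : ∀ {d} → (Fin d → Bool) → ℕ
countB {d} p = sum (map (λ i → if p i then 1 else 0) (allFin d))

allB : ∀ {d} → (Fin d → Bool) → Bool
allB {d} p = and (map p (allFin d))

isSingleton : ∀ {d} → Part d → Fin d → Bool
isSingleton f i = allB (λ j → eqF j i ∨ not (same f j i))

-- block(π): number of blocks of size ≥ 2, counted via their minimal elements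
isBlockMin : ∀ {d} → Part d → Fin d → Bool
isBlockMin f i = not (isSingleton f i) ∧
  allB (λ j → not ((suc (toℕ j) ≤ᵇ toℕ i) ∧ same f j i))

block : ∀ {d} → Part d → ℕ
block f = countB (isBlockMin f)

anyB : ∀ {d} → (Fin d → Bool) → Bool
anyB {d} p = or (map p (allFin d))

-- k is an antisingleton of f: k and k+1 (d+1 read as 1) lie in the same
-- block.  In 0-indexed terms: i and j lie in the same block, where
-- toℕ j = toℕ i + 1, or toℕ i = d - 1 and toℕ j = 0.
isAntisingleton : ∀ {d} → Part d → Fin d → Bool
isAntisingleton {d} f i = anyB (λ j →
  ((toℕ j ≡ᵇ suc (toℕ i)) ∨ ((toℕ i ≡ᵇ d ∸ 1) ∧ (toℕ j ≡ᵇ 0))) ∧ same f i j)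

-- Families S of (pairwise disjoint) intervals of [1,d] needed here:
-- the empty family, a single non-wrapped interval [k,l] (1-indexed),
-- and the single wrapped interval [1,d]*.

data Fam : Set where
  none   : Fam
  iv     : (k l : ℕ) → Fam
  whole* : Fam

singletonInS : ∀ {d} → Fam → Fin d → Bool
singletonInS none     i = false
singletonInS (iv k l) i = (k ≤ᵇ suc (toℕ i)) ∧ (suc (toℕ i) ≤ᵇ l)
singletonInS whole*   i = true

-- the antisingleton k = suc (toℕ i) is in S:
--  for k ≤ d-1: {k,k+1} lies in a single interval of S;
--  for k = d: S contains a wrapped interval.
antiInS : ∀ {d} → Fam → Fin d → Bool
antiInS {d} S i with suc (toℕ i) ≡ᵇ d
antiInS none     i | true  = false
antiInS (iv k l) i | true  = false
antiInS whole*   i | true  = true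
antiInS none     i | false = false
antiInS (iv k l) i | false = (k ≤ᵇ suc (toℕ i)) ∧ (suc (suc (toℕ i)) ≤ᵇ l)
antiInS whole*   i | false = true

-- exponent of wt_S(π) = x^(block(π) + s + a)
wtExp : ∀ {d} → Fam → Part d → ℕ
wtExp S f = block f
  + countB (λ i → isSingleton f i ∧ singletonInS S i)
  + countB (λ i → isAntisingleton f i ∧ antiInS S i)

famIdx : ℕ → ℕ → Fam
famIdx d zero = whole*
famIdx d (suc k) = if suc k ≤ᵇ d then iv (suc k) d else none

wtkExp : ∀ {d} → ℕ → Part d → ℕ
wtkExp {d} k f = wtExp (famIdx d k) f

-- Put 2d points on a circle; positions in
-- clockwise order:  the point i ∈ [1,d] sits at position 2i, the primed
-- point j' (1 ≤ j ≤ d) sits at 2(d-j)+1.  So (d-i)' lies between i and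
-- i+1 (1 ≤ i ≤ d-1) and d' (position 1) lies between d and 1.

posU : ∀ {d} → Fin d → ℕ
posU i = 2 * suc (toℕ i)

posP : ∀ {d} → Fin d → ℕ
posP {d} j = suc (2 * (d ∸ suc (toℕ j)))

Between : ℕ → ℕ → ℕ → Set
Between x p q = (p Data.Nat.< x × x Data.Nat.< q) ⊎ (q Data.Nat.< x × x Data.Nat.< p)
  where import Data.Nat

Cross : ℕ → ℕ → ℕ → ℕ → Set
Cross p q r s = (Between r p q × ¬ Between s p q) ⊎ (¬ Between r p q × Between s p q)

-- the convex hulls of the blocks of π (on unprimed points) and of the
-- blocks of σ (on primed points, j' identified with j) are pairwise
-- disjoint: for points on a circle, two hulls of disjoint vertex sets
-- meet iff some chord of one crosses some chord of the other.
HullsDisjoint : ∀ {d} → Part d → Part d → Set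
HullsDisjoint {d} π σ = (a c b e : Fin d) → π a ≡ π c → σ b ≡ σ e →
  ¬ Cross (posU a) (posU c) (posP b) (posP e)

Refines : ∀ {d} → Part d → Part d → Set
Refines {d} τ σ = (i j : Fin d) → τ i ≡ τ j → σ i ≡ σ j

IsAlpha : ∀ {d} → Part d → Part d → Set
IsAlpha π σ = NonCrossing σ × HullsDisjoint π σ ×
  ((τ : Part _) → NonCrossing τ → HullsDisjoint π τ → Refines τ σ)

-- Put the primed point j′ in the gap just before the element opposite j.
-- Two primed points can lie in one block of α(π) exactly when the chord
-- joining their gaps crosses no block of π; so α(π) is the partition of
-- the gaps by this relation, and every question about α(π) becomes one
-- about π.  Reflecting through before j, the element just before the gap
-- of j′, gives three dualities: j is an antisingleton of α(π) iff before j
-- is a singleton of π; j is a singleton of α(π) iff before j is an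
-- antisingleton of π; and π and α(π) have d + 1 blocks together, since j
-- fails to be the least element of its block of α(π) exactly when
-- opposite j is the least element of a block of π other than that of d.
-- The interval families of wt_k and wt_{d+1-k} are exchanged by the same
-- reflection up to complement, so the two exponents add up to
-- (block + singletons)(π) + (block + singletons)(α(π)), the total number
-- of blocks, d + 1.

module Submission where

open import Defs
open import Data.Nat using (ℕ; suc; _+_; _∸_; _≤_)
open import Data.Product using (Σ; _×_)
open import Relation.Binary.PropositionalEquality using (_≡_)

open import Algebra.Bundles using (CommutativeRing)
import Algebra.Properties.CommutativeMonoid.Sum as CommutativeMonoidSum
import Algebra.Properties.CommutativeSemigroup as CommutativeSemigroupProperties
open import Data.Bool using (Bool; true; false; not; _∧_; _∨_; _xor_; T; b≤b; f≤t; if_then_else_)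
  renaming (_≤_ to _≤𝔹_)
open import Data.Bool.Properties
  using (⇔→≡; ¬-not; xor-same; xor-comm; xor-assoc; xor-∧-commutativeRing;
         not-injective; xor-identityʳ; ∧-conicalˡ; ∧-conicalʳ; ∨-identityʳ; ∧-identityʳ;
         ∧-zeroʳ; ∨-zeroʳ)
open import Data.Bool.ListAction using (and; or)
open import Data.Fin as Fin using (Fin; toℕ; opposite; fromℕ; fromℕ<; inject₁)
import Data.Fin.Properties as FinP
open import Data.Fin.Permutation using (permutation)
open import Data.List using (map; tabulate)
import Data.Nat as ℕ
open import Data.Nat using (zero; _<_; _≤ᵇ_; _≡ᵇ_; _≤?_; z≤n; s≤s; _*_)
import Data.Nat.ListAction as ℕList
open import Data.Nat.Tactic.RingSolver using (solve-∀)
import Data.Nat.Properties as ℕP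
open import Data.Product using (_,_; proj₁; proj₂; ∃)
open import Data.Sum using (_⊎_; inj₁; inj₂; [_,_])
open import Function using (_∘_; _⇔_; mk⇔; Equivalence)
open import Function.Properties.Equivalence using () renaming (trans to ⇔-trans)
open import Relation.Binary.Definitions using (tri<; tri≈; tri>)
open import Relation.Binary.PropositionalEquality
  using (refl; sym; trans; cong; cong₂; subst; subst₂; _≢_; module ≡-Reasoning)
open import Relation.Nullary using (¬_; Dec; yes; no; does; contradiction)
import Relation.Nullary.Decidable
open import Relation.Nullary.Decidable using (dec-true; dec-false; _→-dec_; decidable-stable)
open import Relation.Nullary.Reflects using (Reflects; ofʸ; ofⁿ; invert)

open Equivalence using (to; from)

bool-≡ : {a b : Bool} → (a ≡ true → b ≡ true) → (b ≡ true → a ≡ true) → a ≡ b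
bool-≡ a⇒b b⇒a = ⇔→≡ (mk⇔ a⇒b b⇒a)

∧-true : {a b : Bool} → a ≡ true → b ≡ true → a ∧ b ≡ true
∧-true = cong₂ _∧_

xor-interchange : ∀ a b c e → (a xor b) xor (c xor e) ≡ (a xor c) xor (b xor e)
xor-interchange = CommutativeSemigroupProperties.interchange
  (CommutativeRing.+-commutativeSemigroup xor-∧-commutativeRing)

xor-cancel-middle : ∀ a b c → (a xor b) xor (b xor c) ≡ a xor c
xor-cancel-middle a b c = begin
  (a xor b) xor (b xor c) ≡⟨ xor-assoc a b (b xor c) ⟩
  a xor (b xor (b xor c)) ≡⟨ cong (a xor_) (sym (xor-assoc b b c)) ⟩
  a xor ((b xor b) xor c) ≡⟨ cong (λ z → a xor (z xor c)) (xor-same b) ⟩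
  a xor c                 ∎
  where open ≡-Reasoning

xor-reflects : {A B : Set} {a b : Bool} → Reflects A a → Reflects B b →
  Reflects ((A × ¬ B) ⊎ (¬ A × B)) (a xor b)
xor-reflects (ofʸ a) (ofʸ b) = ofⁿ [ (λ (_ , ¬b) → ¬b b) , (λ (¬a , _) → ¬a a) ]
xor-reflects (ofʸ a) (ofⁿ ¬b) = ofʸ (inj₁ (a , ¬b))
xor-reflects (ofⁿ ¬a) (ofʸ b) = ofʸ (inj₂ (¬a , b))
xor-reflects (ofⁿ ¬a) (ofⁿ ¬b) = ofⁿ [ (λ (a , _) → ¬a a) , (λ (_ , b) → ¬b b) ]

reflects-map : {A B : Set} {b : Bool} → A ⇔ B → Reflects A b → Reflects B b
reflects-map A⇔B (ofʸ a) = ofʸ (to A⇔B a)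
reflects-map A⇔B (ofⁿ ¬a) = ofⁿ (¬a ∘ from A⇔B)

reflects-xor⇔≢ : {A : Set} (a b : Bool) → Reflects A (a xor b) → A ⇔ (a ≢ b)
reflects-xor⇔≢ true  true  r = mk⇔ (λ x → contradiction x (invert r)) (λ a≢b → contradiction refl a≢b)
reflects-xor⇔≢ true  false r = mk⇔ (λ _ ()) (λ _ → invert r)
reflects-xor⇔≢ false true  r = mk⇔ (λ _ ()) (λ _ → invert r)
reflects-xor⇔≢ false false r = mk⇔ (λ x → contradiction x (invert r)) (λ a≢b → contradiction refl a≢b)

∨-true⁻¹ : ∀ {a b} → a ∨ b ≡ true → a ≡ true ⊎ b ≡ true
∨-true⁻¹ {true}  _ = inj₁ refl
∨-true⁻¹ {false} h = inj₂ h

≤𝔹-from-⇒ : {a b : Bool} → (a ≡ true → b ≡ true) → a ≤𝔹 b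
≤𝔹-from-⇒ {false} {false} _ = b≤b
≤𝔹-from-⇒ {false} {true}  _ = f≤t
≤𝔹-from-⇒ {true}  {true}  _ = b≤b
≤𝔹-from-⇒ {true}  {false} h = contradiction (h refl) λ ()

xor-nested : ∀ {b₁ b₂ b₃ b₄} → b₁ ≤𝔹 b₂ → b₂ ≤𝔹 b₃ → b₃ ≤𝔹 b₄ →
  b₁ xor b₂ ≡ (b₁ xor b₃) ∧ not (b₂ xor b₄)
xor-nested {true}  {true}  {true}  {true}  _ _ _ = refl
xor-nested {false} {true}  {true}  {true}  _ _ _ = refl
xor-nested {false} {false} {true}  {true}  _ _ _ = refl
xor-nested {false} {false} {false} {_}     _ _ _ = refl
xor-nested {true}  {false} () _ _
xor-nested {_}     {true}  {false} _ () _
xor-nested {_}     {_}     {true}  {false} _ _ ()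

≤ᵇ-true : ∀ {m k} → m ≤ k → (m ≤ᵇ k) ≡ true
≤ᵇ-true {m} {k} = dec-true (m ≤? k)

≤ᵇ-false : ∀ {m k} → k < m → (m ≤ᵇ k) ≡ false
≤ᵇ-false {m} {k} k<m = dec-false (m ≤? k) (ℕP.<⇒≱ k<m)

≤ᵇ-true⁻¹ : ∀ {m k} → (m ≤ᵇ k) ≡ true → m ≤ k
≤ᵇ-true⁻¹ {m} {k} h = ℕP.≤ᵇ⇒≤ m k (subst T (sym h) _)

≤ᵇ-antitone : ∀ {t s} x → t ≤ s → (s ≤ᵇ x) ≤𝔹 (t ≤ᵇ x)
≤ᵇ-antitone x t≤s = ≤𝔹-from-⇒ (λ h → ≤ᵇ-true (ℕP.≤-trans t≤s (≤ᵇ-true⁻¹ h)))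

≤ᵇ-suc : ∀ m k → (suc m ≤ᵇ suc k) ≡ (m ≤ᵇ k)
≤ᵇ-suc m k = bool-≡ (λ h → ≤ᵇ-true (ℕ.s≤s⁻¹ (≤ᵇ-true⁻¹ {suc m} h)))
                    (λ h → ≤ᵇ-true (s≤s (≤ᵇ-true⁻¹ {m} h)))

≡ᵇ-true : ∀ {m k} → m ≡ k → (m ≡ᵇ k) ≡ true
≡ᵇ-true {m} {k} = dec-true (m ℕ.≟ k)

≡ᵇ-false : ∀ {m k} → m ≢ k → (m ≡ᵇ k) ≡ false
≡ᵇ-false {m} {k} = dec-false (m ℕ.≟ k)

≡ᵇ-true⁻¹ : ∀ {m k} → (m ≡ᵇ k) ≡ true → m ≡ k
≡ᵇ-true⁻¹ {m} {k} h = ℕP.≡ᵇ⇒≡ m k (subst T (sym h) _)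

odd<even⇔ : ∀ {t v} → suc (2 * t) < 2 * suc v ⇔ t ≤ v
odd<even⇔ {t} {v} = mk⇔
  (λ lt → ℕP.*-cancelˡ-≤ 2 (ℕ.s≤s⁻¹ (ℕ.s≤s⁻¹ (subst (suc (2 * t) <_) (ℕP.*-suc 2 v) lt))))
  (λ t≤v → subst (suc (2 * t) <_) (sym (ℕP.*-suc 2 v)) (s≤s (s≤s (ℕP.*-monoʳ-≤ 2 t≤v))))

even<odd⇔ : ∀ {u t} → 2 * suc u < suc (2 * t) ⇔ u < t
even<odd⇔ {u} {t} = mk⇔
  (λ lt → ℕP.*-cancelˡ-≤ 2 (ℕ.s≤s⁻¹ lt))
  (λ u<t → s≤s (ℕP.*-monoʳ-≤ 2 u<t))

-- Chords between gaps

-- Gap t is the arc just before element t (it holds position 2t + 1 of posP),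
-- gap 0 being the one between the last element and element 0.  The chord
-- joining gaps t and s splits the elements into two sides, and side t s x
-- tells on which one x lies.
side : ℕ → ℕ → ℕ → Bool
side t s x = (t ≤ᵇ x) xor (s ≤ᵇ x)

side-refl : ∀ t x → side t t x ≡ false
side-refl t x = xor-same (t ≤ᵇ x)

side-sym : ∀ t s x → side t s x ≡ side s t x
side-sym t s x = xor-comm (t ≤ᵇ x) (s ≤ᵇ x)

side-trans : ∀ t s r x → side t s x xor side s r x ≡ side t r x
side-trans t s r x = xor-cancel-middle (t ≤ᵇ x) (s ≤ᵇ x) (r ≤ᵇ x)

side-nested : ∀ {t₁ t₂ t₃ t₄} x → t₄ ≤ t₃ → t₃ ≤ t₂ → t₂ ≤ t₁ →
  side t₁ t₂ x ≡ side t₁ t₃ x ∧ not (side t₂ t₄ x)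
side-nested x t₄≤t₃ t₃≤t₂ t₂≤t₁ =
  xor-nested (≤ᵇ-antitone x t₂≤t₁) (≤ᵇ-antitone x t₃≤t₂) (≤ᵇ-antitone x t₄≤t₃)

between⇔ : ∀ t u v → ((t ≤ u × ¬ t ≤ v) ⊎ (¬ t ≤ u × t ≤ v)) ⇔
  Between (suc (2 * t)) (2 * suc u) (2 * suc v)
between⇔ t u v = mk⇔
  [ (λ (t≤u , t≰v) → inj₂ (from even<odd⇔ (ℕP.≰⇒> t≰v) , from odd<even⇔ t≤u))
  , (λ (t≰u , t≤v) → inj₁ (from even<odd⇔ (ℕP.≰⇒> t≰u) , from odd<even⇔ t≤v)) ]
  [ (λ (u<t , t<v) → inj₂ (ℕP.<⇒≱ (to even<odd⇔ u<t) , to odd<even⇔ t<v))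
  , (λ (v<t , t<u) → inj₁ (to odd<even⇔ t<u , ℕP.<⇒≱ (to even<odd⇔ v<t))) ]

between-reflects : ∀ t u v →
  Reflects (Between (suc (2 * t)) (2 * suc u) (2 * suc v)) ((t ≤ᵇ u) xor (t ≤ᵇ v))
between-reflects t u v = reflects-map (between⇔ t u v)
  (xor-reflects (ℕP.≤ᵇ-reflects-≤ t u) (ℕP.≤ᵇ-reflects-≤ t v))

cross⇔sides-differ : ∀ t s u v →
  Cross (2 * suc u) (2 * suc v) (suc (2 * t)) (suc (2 * s)) ⇔ (side t s u ≢ side t s v)
cross⇔sides-differ t s u v = reflects-xor⇔≢ (side t s u) (side t s v)
  (subst (Reflects _) (xor-interchange (t ≤ᵇ u) (t ≤ᵇ v) (s ≤ᵇ u) (s ≤ᵇ v))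
    (xor-reflects (between-reflects t u v) (between-reflects s u v)))

side-span : ∀ {m M} x → m ≤ M → side m (suc M) x ≡ (m ≤ᵇ x) ∧ (x ≤ᵇ M)
side-span {m} {M} x m≤M with ℕP.≤-<-connex x M
... | inj₁ x≤M rewrite ≤ᵇ-false {suc M} {x} (s≤s x≤M) | ≤ᵇ-true x≤M =
  trans (xor-identityʳ (m ≤ᵇ x)) (sym (∧-identityʳ (m ≤ᵇ x)))
... | inj₂ M<x rewrite ≤ᵇ-true {suc M} {x} M<x | ≤ᵇ-false {x} {M} M<x
                     | ≤ᵇ-true {m} {x} (ℕP.≤-trans m≤M (ℕP.<⇒≤ M<x)) = refl

side-span-to-0 : ∀ {m M} x → x ≤ M → side m 0 x ≡ not ((m ≤ᵇ x) ∧ (x ≤ᵇ M))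
side-span-to-0 {m} x x≤M rewrite ≤ᵇ-true x≤M | ∧-identityʳ (m ≤ᵇ x) with m ≤ᵇ x
... | true  = refl
... | false = refl

side-neighbours : ∀ s x → side (suc s) s x ≡ (x ≡ᵇ s)
side-neighbours s x with ℕP.<-cmp x s
... | tri< x<s _ _ rewrite ≤ᵇ-false {suc s} {x} (ℕP.m<n⇒m<1+n x<s) | ≤ᵇ-false x<s
                         | ≡ᵇ-false (ℕP.<⇒≢ x<s) = refl
... | tri≈ _ refl _ rewrite ≤ᵇ-false {suc x} {x} (ℕP.n<1+n x) | ≤ᵇ-true (ℕP.≤-refl {x})
                          | ≡ᵇ-true {x} refl = refl
... | tri> _ _ s<x rewrite ≤ᵇ-true {suc s} {x} s<x | ≤ᵇ-true (ℕP.<⇒≤ s<x)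
                         | ≡ᵇ-false (ℕP.>⇒≢ s<x) = refl

side-neighbours-wrap : ∀ {n} x → x ≤ n → side 0 n x ≡ not (x ≡ᵇ n)
side-neighbours-wrap {n} x x≤n = cong not (bool-≡
  (λ h → ≡ᵇ-true (ℕP.≤-antisym x≤n (≤ᵇ-true⁻¹ {n} h)))
  (λ h → ≤ᵇ-true (ℕP.≤-reflexive (sym (≡ᵇ-true⁻¹ {x} h)))))

side-both-≤ : ∀ {t s x} → t ≤ x → s ≤ x → side t s x ≡ false
side-both-≤ t≤x s≤x rewrite ≤ᵇ-true t≤x | ≤ᵇ-true s≤x = refl

side-both-> : ∀ {t s x} → x < t → x < s → side t s x ≡ false
side-both-> x<t x<s rewrite ≤ᵇ-false x<t | ≤ᵇ-false x<s = refl

side-inside : ∀ {t s x} → s ≤ x → x < t → side t s x ≡ true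
side-inside s≤x x<t rewrite ≤ᵇ-false x<t | ≤ᵇ-true s≤x = refl

private
  and-map⇔ : ∀ {m d} (p : Fin d → Bool) (g : Fin m → Fin d) →
    and (map p (tabulate g)) ≡ true ⇔ (∀ i → p (g i) ≡ true)
  and-map⇔ {zero}  p g = mk⇔ (λ _ ()) (λ _ → refl)
  and-map⇔ {suc m} p g = mk⇔
    (λ { h Fin.zero    → ∧-conicalˡ _ _ h
       ; h (Fin.suc i) → to (and-map⇔ p (g ∘ Fin.suc)) (∧-conicalʳ _ _ h) i })
    (λ h → ∧-true (h Fin.zero) (from (and-map⇔ p (g ∘ Fin.suc)) (h ∘ Fin.suc)))

  or-map⇔ : ∀ {m d} (p : Fin d → Bool) (g : Fin m → Fin d) →
    or (map p (tabulate g)) ≡ true ⇔ (∃ λ i → p (g i) ≡ true)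
  or-map⇔ {zero}  p g = mk⇔ (λ ()) (λ ())
  or-map⇔ {suc m} p g = mk⇔ to′ from′
    where
    to′ : or (map p (tabulate g)) ≡ true → ∃ λ i → p (g i) ≡ true
    to′ h with p (g Fin.zero) in eq
    ... | true  = Fin.zero , eq
    ... | false = let (i , q) = to (or-map⇔ p (g ∘ Fin.suc)) h in Fin.suc i , q
    from′ : (∃ λ i → p (g i) ≡ true) → or (map p (tabulate g)) ≡ true
    from′ (Fin.zero , q) rewrite q = refl
    from′ (Fin.suc i , q) with p (g Fin.zero)
    ... | true  = refl
    ... | false = from (or-map⇔ p (g ∘ Fin.suc)) (i , q)

allB⇔ : ∀ {d} (p : Fin d → Bool) → allB p ≡ true ⇔ (∀ i → p i ≡ true)
allB⇔ p = and-map⇔ p (λ i → i)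

allB-false : ∀ {d} (p : Fin d → Bool) → allB p ≡ false → ∃ λ i → p i ≡ false
allB-false {d} p h =
  let (i , ¬pi) = FinP.¬∀⟶∃¬ d (λ i → p i ≡ true) (λ i → p i Data.Bool.≟ true)
                    (λ all → contradiction (trans (sym h) (from (allB⇔ p) all)) λ ())
  in i , ¬-not ¬pi

anyB⇔ : ∀ {d} (p : Fin d → Bool) → anyB p ≡ true ⇔ (∃ λ i → p i ≡ true)
anyB⇔ p = or-map⇔ p (λ i → i)

least-witness : ∀ {d} (P : Fin d → Set) → (∀ i → Dec (P i)) → ∀ w → P w →
  Σ (Fin d) λ k → P k × (∀ x → P x → toℕ k ≤ toℕ x)
least-witness {suc d} P P? w Pw with P? Fin.zero
least-witness P P? w           Pw | yes P0 = Fin.zero , P0 , λ _ _ → z≤n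
least-witness P P? Fin.zero    Pw | no ¬P0 = contradiction Pw ¬P0
least-witness P P? (Fin.suc w) Pw | no ¬P0 =
  let (k , Pk , k-least) = least-witness (P ∘ Fin.suc) (P? ∘ Fin.suc) w Pw
  in Fin.suc k , Pk , λ { Fin.zero P0 → contradiction P0 ¬P0 ; (Fin.suc x) Px → s≤s (k-least x Px) }

greatest-witness : ∀ {d} (P : Fin d → Set) → (∀ i → Dec (P i)) → ∀ w → P w →
  Σ (Fin d) λ k → P k × (∀ x → P x → toℕ x ≤ toℕ k)
greatest-witness {suc m} P P? w Pw =
  let (k , Pk , k-least) = least-witness (P ∘ opposite) (P? ∘ opposite) (opposite w)
                             (subst P (sym (FinP.opposite-involutive w)) Pw)
  in opposite k , Pk , λ x Px →
       reflect k x (k-least (opposite x) (subst P (sym (FinP.opposite-involutive x)) Px))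
  where
  reflect : ∀ k x → toℕ k ≤ toℕ (opposite x) → toℕ x ≤ toℕ (opposite k)
  reflect k x k≤x′ rewrite FinP.opposite-prop k | FinP.opposite-prop x =
    subst (_≤ m ∸ toℕ k) (ℕP.m∸[m∸n]≡n (ℕ.s≤s⁻¹ (FinP.toℕ<n x))) (ℕP.∸-monoʳ-≤ m k≤x′)

indicator : Bool → ℕ
indicator b = if b then 1 else 0

open CommutativeMonoidSum ℕP.+-0-commutativeMonoid
  using (sum; sum-cong-≗; ∑-distrib-+; sum-permute)

countB≡sum : ∀ {d} (p : Fin d → Bool) → countB p ≡ sum (indicator ∘ p)
countB≡sum p = go p (λ i → i)
  where
  go : ∀ {m d} (p : Fin d → Bool) (g : Fin m → Fin d) →
    ℕList.sum (map (indicator ∘ p) (tabulate g)) ≡ sum (indicator ∘ p ∘ g)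
  go {zero}  p g = refl
  go {suc m} p g = cong (indicator (p (g Fin.zero)) +_) (go p (g ∘ Fin.suc))

countB-cong : ∀ {d} {p q : Fin d → Bool} → (∀ i → p i ≡ q i) → countB p ≡ countB q
countB-cong {p = p} {q} p≗q = begin
  countB p             ≡⟨ countB≡sum p ⟩
  sum (indicator ∘ p)  ≡⟨ sum-cong-≗ (cong indicator ∘ p≗q) ⟩
  sum (indicator ∘ q)  ≡⟨ countB≡sum q ⟨
  countB q             ∎
  where open ≡-Reasoning

countB-involution : ∀ {d} (p : Fin d → Bool) (g : Fin d → Fin d) → (∀ i → g (g i) ≡ i) →
  countB p ≡ countB (p ∘ g)
countB-involution p g g∘g = begin
  countB p                 ≡⟨ countB≡sum p ⟩
  sum (indicator ∘ p)      ≡⟨ sum-permute (indicator ∘ p) (permutation g g g∘g g∘g) ⟩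
  sum (indicator ∘ p ∘ g)  ≡⟨ countB≡sum (p ∘ g) ⟨
  countB (p ∘ g)           ∎
  where open ≡-Reasoning

countB-+ : ∀ {d} (p q : Fin d → Bool) (f : Fin d → ℕ) →
  (∀ i → indicator (p i) + indicator (q i) ≡ f i) → countB p + countB q ≡ sum f
countB-+ p q f h = begin
  countB p + countB q                                ≡⟨ cong₂ _+_ (countB≡sum p) (countB≡sum q) ⟩
  sum (indicator ∘ p) + sum (indicator ∘ q)          ≡⟨ ∑-distrib-+ (indicator ∘ p) (indicator ∘ q) ⟨
  sum (λ i → indicator (p i) + indicator (q i))      ≡⟨ sum-cong-≗ h ⟩
  sum f                                              ∎
  where open ≡-Reasoning

countB-∧-split : ∀ {d} (p q : Fin d → Bool) →
  countB (λ i → p i ∧ q i) + countB (λ i → p i ∧ not (q i)) ≡ countB p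
countB-∧-split p q = trans (countB-+ _ _ (indicator ∘ p) (λ i → split (p i) (q i))) (sym (countB≡sum p))
  where
  split : ∀ a b → indicator (a ∧ b) + indicator (a ∧ not b) ≡ indicator a
  split true  true  = refl
  split true  false = refl
  split false _     = refl

countB-∨-not : ∀ {d} (p q : Fin d → Bool) →
  countB p + countB (λ i → not (p i) ∨ q i) ≡ d + countB (λ i → p i ∧ q i)
countB-∨-not {d} p q = begin
  countB p + countB (λ i → not (p i) ∨ q i)     ≡⟨ countB-+ _ _ _ (λ i → split (p i) (q i)) ⟩
  sum (λ i → 1 + indicator (p i ∧ q i))         ≡⟨ ∑-distrib-+ (λ _ → 1) (λ i → indicator (p i ∧ q i)) ⟩
  sum {d} (λ _ → 1) + sum (λ i → indicator (p i ∧ q i))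
    ≡⟨ cong₂ _+_ (sum-one d) (sym (countB≡sum (λ i → p i ∧ q i))) ⟩
  d + countB (λ i → p i ∧ q i)                  ∎
  where
  open ≡-Reasoning
  split : ∀ a b → indicator a + indicator (not a ∨ b) ≡ 1 + indicator (a ∧ b)
  split true  true  = refl
  split true  false = refl
  split false _     = refl
  sum-one : ∀ m → sum {m} (λ _ → 1) ≡ m
  sum-one zero    = refl
  sum-one (suc m) = cong suc (sum-one m)

countB-eqF : ∀ {d} (k : Fin d) → countB (λ i → eqF i k) ≡ 1
countB-eqF k = trans (countB≡sum (λ i → eqF i k)) (go k)
  where
  sum-zero : ∀ m → sum {m} (λ _ → 0) ≡ 0
  sum-zero zero    = refl
  sum-zero (suc m) = sum-zero m
  go : ∀ {d} (k : Fin d) → sum (λ i → indicator (eqF i k)) ≡ 1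
  go {suc d} Fin.zero    = cong suc (sum-zero d)
  go         (Fin.suc k) = go k

does-true⁻¹ : {A : Set} (a? : Dec A) → does a? ≡ true → A
does-true⁻¹ (yes a) _ = a

eqF-refl : ∀ {d} (i : Fin d) → eqF i i ≡ true
eqF-refl i = dec-true (i FinP.≟ i) refl

eqF≡≡ᵇ : ∀ {d} (i j : Fin d) → eqF i j ≡ (toℕ i ≡ᵇ toℕ j)
eqF≡≡ᵇ i j = bool-≡
  (λ h → ≡ᵇ-true (cong toℕ (does-true⁻¹ (i FinP.≟ j) h)))
  (λ h → dec-true (i FinP.≟ j) (FinP.toℕ-injective (≡ᵇ-true⁻¹ h)))

same-true : ∀ {d} (f : Part d) {i j} → f i ≡ f j → same f i j ≡ true
same-true f {i} {j} = dec-true (f i FinP.≟ f j)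

same-false : ∀ {d} (f : Part d) {i j} → f i ≢ f j → same f i j ≡ false
same-false f {i} {j} = dec-false (f i FinP.≟ f j)

same-true⁻¹ : ∀ {d} (f : Part d) {i j} → same f i j ≡ true → f i ≡ f j
same-true⁻¹ f {i} {j} = does-true⁻¹ (f i FinP.≟ f j)

isSingleton⇔ : ∀ {d} (f : Part d) i → isSingleton f i ≡ true ⇔ (∀ j → f j ≡ f i → j ≡ i)
isSingleton⇔ f i = mk⇔
  (λ h j fj≡fi → does-true⁻¹ (j FinP.≟ i)
     (trans (sym (∨-identityʳ (eqF j i)))
       (subst (λ b → eqF j i ∨ not b ≡ true) (same-true f fj≡fi) (to (allB⇔ _) h j))))
  (λ h → from (allB⇔ _) (lonely h))
  where
  lonely : (∀ j → f j ≡ f i → j ≡ i) → ∀ j → eqF j i ∨ not (same f j i) ≡ true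
  lonely h j with f j FinP.≟ f i
  ... | yes fj≡fi rewrite h j fj≡fi | eqF-refl i = refl
  ... | no  _     = ∨-zeroʳ (eqF j i)

isLeast : ∀ {d} → Part d → Fin d → Bool
isLeast f i = allB (λ j → not ((suc (toℕ j) ≤ᵇ toℕ i) ∧ same f j i))

isLeast⇔ : ∀ {d} (f : Part d) i → isLeast f i ≡ true ⇔ (∀ j → toℕ j < toℕ i → f j ≢ f i)
isLeast⇔ f i = mk⇔
  (λ h j j<i fj≡fi → contradiction
     (subst (λ b → not b ≡ true) (∧-true (≤ᵇ-true j<i) (same-true f fj≡fi)) (to (allB⇔ _) h j)) λ ())
  (λ h → from (allB⇔ _) (λ j → earlier h j (toℕ j ℕ.<? toℕ i)))
  where
  earlier : (∀ j → toℕ j < toℕ i → f j ≢ f i) → ∀ j → Dec (toℕ j < toℕ i) →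
    not ((suc (toℕ j) ≤ᵇ toℕ i) ∧ same f j i) ≡ true
  earlier h j (yes j<i) rewrite same-false f (h j j<i) = cong not (∧-zeroʳ _)
  earlier h j (no  j≮i) rewrite ≤ᵇ-false {suc (toℕ j)} {toℕ i} (ℕP.≰⇒> j≮i) = refl

isLeast-false : ∀ {d} (f : Part d) i → isLeast f i ≡ false → ∃ λ j → toℕ j < toℕ i × f j ≡ f i
isLeast-false f i h =
  let (j , earlier) = allB-false _ h
      both = not-injective earlier
  in j , ≤ᵇ-true⁻¹ (∧-conicalˡ _ _ both) , same-true⁻¹ f (∧-conicalʳ _ _ both)

least-in-block : ∀ {d} (f : Part d) y → ∃ λ m → ∀ w → isLeast f w ∧ same f w y ≡ eqF w m
least-in-block f y = m , λ w → bool-≡ (is-m w) (m-is w)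
  where
  witness = least-witness (λ x → f x ≡ f y) (λ x → f x FinP.≟ f y) y refl
  m = proj₁ witness
  fm≡fy = proj₁ (proj₂ witness)
  m-least = proj₂ (proj₂ witness)
  is-m : ∀ w → isLeast f w ∧ same f w y ≡ true → eqF w m ≡ true
  is-m w h =
    let fw≡fy = same-true⁻¹ f (∧-conicalʳ (isLeast f w) _ h)
        w≤m = ℕP.≮⇒≥ λ m<w → to (isLeast⇔ f w) (∧-conicalˡ _ _ h) m m<w (trans fm≡fy (sym fw≡fy))
    in dec-true (w FinP.≟ m) (FinP.toℕ-injective (ℕP.≤-antisym w≤m (m-least w fw≡fy)))
  m-is : ∀ w → eqF w m ≡ true → isLeast f w ∧ same f w y ≡ true
  m-is w h with does-true⁻¹ (w FinP.≟ m) h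
  ... | refl = ∧-true (from (isLeast⇔ f w) λ j j<w fj≡fw → ℕP.<⇒≱ j<w (m-least j (trans fj≡fw fm≡fy)))
                      (same-true f fm≡fy)

singleton⇒least : ∀ {d} (f : Part d) i → isSingleton f i ≡ true → isLeast f i ≡ true
singleton⇒least f i h = from (isLeast⇔ f i)
  (λ j j<i fj≡fi → ℕP.<-irrefl (cong toℕ (to (isSingleton⇔ f i) h j fj≡fi)) j<i)

block+singletons : ∀ {d} (f : Part d) → block f + countB (isSingleton f) ≡ countB (isLeast f)
block+singletons f =
  trans (countB-+ _ _ (indicator ∘ isLeast f) (λ i → split (singleton⇒least f i)))
        (sym (countB≡sum (isLeast f)))
  where
  split : ∀ {s l} → (s ≡ true → l ≡ true) → indicator (not s ∧ l) + indicator s ≡ indicator l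
  split {true}  {true}  _ = refl
  split {true}  {false} h = contradiction (h refl) λ ()
  split {false} {_}     _ = ℕP.+-identityʳ _

cpred : ∀ {n} → Fin (suc n) → Fin (suc n)
cpred Fin.zero    = fromℕ _
cpred (Fin.suc i) = inject₁ i

cpred-cases : ∀ {n} (w : Fin (suc n)) →
  (toℕ w ≡ 0 × toℕ (cpred w) ≡ n) ⊎ (toℕ w ≡ suc (toℕ (cpred w)))
cpred-cases {n} Fin.zero    = inj₁ (refl , FinP.toℕ-fromℕ n)
cpred-cases     (Fin.suc i) = inj₂ (cong suc (sym (FinP.toℕ-inject₁ i)))

succeeds-cpred : ∀ {n} (w j : Fin (suc n)) →
  ((toℕ j ≡ᵇ suc (toℕ (cpred w))) ∨ ((toℕ (cpred w) ≡ᵇ n) ∧ (toℕ j ≡ᵇ 0))) ≡ eqF j w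
succeeds-cpred {n} Fin.zero j
  rewrite FinP.toℕ-fromℕ n
        | ≡ᵇ-false {toℕ j} {suc n} (ℕP.<⇒≢ (FinP.toℕ<n j))
        | ≡ᵇ-true {n} refl = sym (eqF≡≡ᵇ j Fin.zero)
succeeds-cpred {n} (Fin.suc i) j
  rewrite FinP.toℕ-inject₁ i
        | ≡ᵇ-false {toℕ i} {n} (ℕP.<⇒≢ (FinP.toℕ<n i)) =
  trans (∨-identityʳ _) (sym (eqF≡≡ᵇ j (Fin.suc i)))

isAntisingleton-cpred : ∀ {n} (f : Part (suc n)) w →
  isAntisingleton f (cpred w) ≡ same f (cpred w) w
isAntisingleton-cpred f w = bool-≡
  (λ h → let (j , q) = to (anyB⇔ _) h
             j≡w = does-true⁻¹ (j FinP.≟ w) (trans (sym (succeeds-cpred w j)) (∧-conicalˡ _ _ q))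
         in subst (λ k → same f (cpred w) k ≡ true) j≡w (∧-conicalʳ _ _ q))
  (λ h → from (anyB⇔ _) (w , ∧-true (trans (succeeds-cpred w w) (eqF-refl w)) h))

-- The primed point j of the Simion–Ullman picture lies in gap (gap j),
-- between the elements before j and opposite j.
gap : ∀ {n} → Fin (suc n) → ℕ
gap j = toℕ (opposite j)

before : ∀ {n} → Fin (suc n) → Fin (suc n)
before j = cpred (opposite j)

posP≡ : ∀ {n} (j : Fin (suc n)) → posP j ≡ suc (2 * gap j)
posP≡ j = cong (λ t → suc (2 * t)) (sym (FinP.opposite-prop j))

gap-opposite : ∀ {n} (x : Fin (suc n)) → gap (opposite x) ≡ toℕ x
gap-opposite x = cong toℕ (FinP.opposite-involutive x)

gap-injective : ∀ {n} {j j′ : Fin (suc n)} → gap j ≡ gap j′ → j ≡ j′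
gap-injective {j = j} {j′} e = trans (sym (FinP.opposite-involutive j))
  (trans (cong opposite (FinP.toℕ-injective e)) (FinP.opposite-involutive j′))

gap-antitone : ∀ {n} {j j′ : Fin (suc n)} → toℕ j ≤ toℕ j′ → gap j′ ≤ gap j
gap-antitone {n} {j} {j′} j≤j′ rewrite FinP.opposite-prop j | FinP.opposite-prop j′ =
  ℕP.∸-monoʳ-≤ n j≤j′

gap-strictly-antitone : ∀ {n} {j j′ : Fin (suc n)} → toℕ j < toℕ j′ → gap j′ < gap j
gap-strictly-antitone {n} {j} {j′} j<j′ rewrite FinP.opposite-prop j | FinP.opposite-prop j′ =
  ℕP.∸-monoʳ-< j<j′ (ℕ.s≤s⁻¹ (FinP.toℕ<n j′))

gap≤n : ∀ {n} (j : Fin (suc n)) → gap j ≤ n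
gap≤n j = ℕ.s≤s⁻¹ (FinP.toℕ<n (opposite j))

before-cases : ∀ {n} (j : Fin (suc n)) →
  (toℕ j ≡ n × toℕ (before j) ≡ n) ⊎ (toℕ j < n × toℕ (before j) ≡ n ∸ suc (toℕ j))
before-cases {n} j with cpred-cases (opposite j)
... | inj₁ (w≡0 , b≡n) =
  inj₁ ( ℕP.≤-antisym (ℕ.s≤s⁻¹ (FinP.toℕ<n j))
                      (ℕP.m∸n≡0⇒m≤n (trans (sym (FinP.opposite-prop j)) w≡0))
       , b≡n)
... | inj₂ w≡1+b =
  let n∸j≡1+b = trans (sym (FinP.opposite-prop j)) w≡1+b
  in inj₂ ( ℕP.m∸n≢0⇒n<m (λ z → ℕP.0≢1+n (trans (sym z) n∸j≡1+b))
          , sym (trans (sym (ℕP.pred[m∸n]≡m∸[1+n] n (toℕ j))) (cong ℕ.pred n∸j≡1+b)))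

before-involutive : ∀ {n} (j : Fin (suc n)) → before (before j) ≡ j
before-involutive {n} j = FinP.toℕ-injective (twice (before-cases j) (before-cases (before j)))
  where
  twice : _ → _ → toℕ (before (before j)) ≡ toℕ j
  twice (inj₁ (j≡n , _))     (inj₁ (_ , bbj≡n))     = trans bbj≡n (sym j≡n)
  twice (inj₁ (_ , bj≡n))    (inj₂ (bj<n , _))      = contradiction bj<n (ℕP.<-irrefl bj≡n)
  twice (inj₂ (j<n , bj≡))   (inj₁ (bj≡n , _))      =
    contradiction (ℕP.∸-monoʳ-< (s≤s z≤n) j<n) (ℕP.<-irrefl (trans (sym bj≡) bj≡n))
  twice (inj₂ (j<n , bj≡))   (inj₂ (_ , bbj≡))      = begin
    toℕ (before (before j))       ≡⟨ bbj≡ ⟩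
    n ∸ suc (toℕ (before j))      ≡⟨ cong (λ x → n ∸ suc x) bj≡ ⟩
    n ∸ suc (n ∸ suc (toℕ j))     ≡⟨ ℕP.pred[m∸n]≡m∸[1+n] n (n ∸ suc (toℕ j)) ⟨
    ℕ.pred (n ∸ (n ∸ suc (toℕ j))) ≡⟨ cong ℕ.pred (ℕP.m∸[m∸n]≡n j<n) ⟩
    toℕ j                          ∎
    where open ≡-Reasoning

side-separates-neighbours : ∀ {n} t (w : Fin (suc n)) → t ≤ n → t ≢ toℕ w →
  side t (toℕ w) (toℕ (cpred w)) ≢ side t (toℕ w) (toℕ w)
side-separates-neighbours {n} zero    Fin.zero    _   t≢0 = contradiction refl t≢0
side-separates-neighbours {n} (suc t) Fin.zero    t≤n _
  rewrite FinP.toℕ-fromℕ n | ≤ᵇ-true t≤n = λ ()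
side-separates-neighbours {n} t       (Fin.suc i) _   t≢w
  rewrite FinP.toℕ-inject₁ i with ℕP.<-cmp t (suc (toℕ i))
... | tri< t<w _ _ rewrite ≤ᵇ-true (ℕ.s≤s⁻¹ t<w) | ≤ᵇ-true (ℕP.<⇒≤ t<w)
                         | ≤ᵇ-false {suc (toℕ i)} {toℕ i} (ℕP.n<1+n _)
                         | ≤ᵇ-true (ℕP.≤-refl {suc (toℕ i)}) = λ ()
... | tri≈ _ t≡w _ = contradiction t≡w t≢w
... | tri> _ _ w<t rewrite ≤ᵇ-false {t} {toℕ i} (ℕP.<-trans (ℕP.n<1+n _) w<t) | ≤ᵇ-false w<t
                         | ≤ᵇ-false {suc (toℕ i)} {toℕ i} (ℕP.n<1+n _)
                         | ≤ᵇ-true (ℕP.≤-refl {suc (toℕ i)}) = λ ()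

side-around : ∀ {n} (w : Fin (suc n)) →
  (∀ y → side (toℕ w) (toℕ (cpred w)) (toℕ y) ≡ eqF y (cpred w)) ⊎
  (∀ y → side (toℕ w) (toℕ (cpred w)) (toℕ y) ≡ not (eqF y (cpred w)))
side-around {n} Fin.zero = inj₂ λ y →
  trans (cong (λ m → side 0 m (toℕ y)) (FinP.toℕ-fromℕ n))
    (trans (side-neighbours-wrap (toℕ y) (ℕ.s≤s⁻¹ (FinP.toℕ<n y)))
      (cong not (trans (cong (toℕ y ≡ᵇ_) (sym (FinP.toℕ-fromℕ n))) (sym (eqF≡≡ᵇ y (fromℕ n))))))
side-around (Fin.suc i) = inj₁ λ y →
  trans (cong (λ m → side (suc m) (toℕ (inject₁ i)) (toℕ y)) (sym (FinP.toℕ-inject₁ i)))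
    (trans (side-neighbours (toℕ (inject₁ i)) (toℕ y)) (sym (eqF≡≡ᵇ y (inject₁ i))))

cross⇔ : ∀ {n} (a c b e : Fin (suc n)) →
  Cross (posU a) (posU c) (posP b) (posP e) ⇔
  (side (gap b) (gap e) (toℕ a) ≢ side (gap b) (gap e) (toℕ c))
cross⇔ a c b e =
  subst₂ (λ p q → Cross (posU a) (posU c) p q ⇔ (sides (toℕ a) ≢ sides (toℕ c)))
    (sym (posP≡ b)) (sym (posP≡ e)) (cross⇔sides-differ (gap b) (gap e) (toℕ a) (toℕ c))
  where sides = side (gap b) (gap e)

-- Chords avoiding a partition, and the Simion–Ullman involution

module Chords {n : ℕ} (π : Part (suc n)) where

  record Avoids (t s : ℕ) : Set where
    constructor avoids
    field same-side : ∀ a c → π a ≡ π c → side t s (toℕ a) ≡ side t s (toℕ c)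
  open Avoids public

  avoids-refl : ∀ t → Avoids t t
  avoids-refl t = avoids λ a c _ → trans (side-refl t (toℕ a)) (sym (side-refl t (toℕ c)))

  avoids-sym : ∀ {t s} → Avoids t s → Avoids s t
  avoids-sym {t} {s} h = avoids λ a c e →
    trans (side-sym s t (toℕ a)) (trans (same-side h a c e) (side-sym t s (toℕ c)))

  avoids-trans : ∀ {t s r} → Avoids t s → Avoids s r → Avoids t r
  avoids-trans {t} {s} {r} p q = avoids λ a c e → begin
    side t r (toℕ a)                        ≡⟨ side-trans t s r (toℕ a) ⟨
    side t s (toℕ a) xor side s r (toℕ a)   ≡⟨ cong₂ _xor_ (same-side p a c e) (same-side q a c e) ⟩
    side t s (toℕ c) xor side s r (toℕ c)   ≡⟨ side-trans t s r (toℕ c) ⟩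
    side t r (toℕ c)                        ∎
    where open ≡-Reasoning

  avoids? : ∀ t s → Dec (Avoids t s)
  avoids? t s = Relation.Nullary.Decidable.map′ avoids same-side (FinP.all? λ a → FinP.all? λ c →
    (π a FinP.≟ π c) →-dec (side t s (toℕ a) Data.Bool.≟ side t s (toℕ c)))

  -- Two primed points can share a block of α(π) iff the chord joining them avoids π.
  Joinable : Fin (suc n) → Fin (suc n) → Set
  Joinable b e = Avoids (gap b) (gap e)

  hullsDisjoint⇔ : ∀ τ → HullsDisjoint π τ ⇔ (∀ b e → τ b ≡ τ e → Joinable b e)
  hullsDisjoint⇔ τ = mk⇔
    (λ hd b e τb≡τe →
       avoids λ a c πa≡πc → decidable-stable (_ Data.Bool.≟ _)
         (λ ne → hd a c b e πa≡πc τb≡τe (from (cross⇔ a c b e) ne)))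
    (λ joinable a c b e πa≡πc τb≡τe cross →
       to (cross⇔ a c b e) cross (same-side (joinable b e τb≡τe) a c πa≡πc))

  private
    leastJoinable : ∀ j → Σ (Fin (suc n)) λ k → Joinable j k × (∀ x → Joinable j x → toℕ k ≤ toℕ x)
    leastJoinable j = least-witness (Joinable j) (λ k → avoids? _ _) j (avoids-refl _)

  alpha : Part (suc n)
  alpha j = proj₁ (leastJoinable j)

  alpha-sound : ∀ b e → alpha b ≡ alpha e → Joinable b e
  alpha-sound b e αb≡αe = avoids-trans (proj₁ (proj₂ (leastJoinable b)))
    (avoids-sym (subst (Joinable e) (sym αb≡αe) (proj₁ (proj₂ (leastJoinable e)))))

  alpha-complete : ∀ b e → Joinable b e → alpha b ≡ alpha e
  alpha-complete b e b~e = FinP.toℕ-injective (ℕP.≤-antisym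
    (proj₂ (proj₂ (leastJoinable b)) (alpha e) (avoids-trans b~e (proj₁ (proj₂ (leastJoinable e)))))
    (proj₂ (proj₂ (leastJoinable e)) (alpha b)
       (avoids-trans (avoids-sym b~e) (proj₁ (proj₂ (leastJoinable b))))))

  alpha-nonCrossing : NonCrossing alpha
  alpha-nonCrossing a b c e a<b b<c c<e αa≡αc αb≡αe = alpha-complete a b (avoids λ x y πx≡πy →
    begin
    side ga gb (toℕ x)                              ≡⟨ nested (toℕ x) ⟩
    side ga gc (toℕ x) ∧ not (side gb ge (toℕ x))   ≡⟨ cong₂ (λ u v → u ∧ not v)
                                                         (same-side (alpha-sound a c αa≡αc) x y πx≡πy)
                                                         (same-side (alpha-sound b e αb≡αe) x y πx≡πy) ⟩
    side ga gc (toℕ y) ∧ not (side gb ge (toℕ y))   ≡⟨ nested (toℕ y) ⟨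
    side ga gb (toℕ y)                              ∎)
    where
    open ≡-Reasoning
    ga = gap a
    gb = gap b
    gc = gap c
    ge = gap e
    nested : ∀ z → side ga gb z ≡ side ga gc z ∧ not (side gb ge z)
    nested z = side-nested z (gap-antitone (ℕP.<⇒≤ c<e)) (gap-antitone (ℕP.<⇒≤ b<c))
                             (gap-antitone (ℕP.<⇒≤ a<b))

  alpha-isAlpha : IsAlpha π alpha
  alpha-isAlpha = alpha-nonCrossing , from (hullsDisjoint⇔ alpha) alpha-sound ,
    λ τ _ hd i j τi≡τj → alpha-complete i j (to (hullsDisjoint⇔ τ) hd i j τi≡τj)

  isAlpha⇒same⇔joinable : ∀ {σ} → IsAlpha π σ → ∀ b e → σ b ≡ σ e ⇔ Joinable b e
  isAlpha⇒same⇔joinable {σ} (_ , hd , coarsest) b e = mk⇔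
    (to (hullsDisjoint⇔ σ) hd b e)
    (λ b~e → coarsest alpha alpha-nonCrossing (from (hullsDisjoint⇔ alpha) alpha-sound) b e
               (alpha-complete b e b~e))

  avoids⇔invariant : ∀ {t s} (g : Fin (suc n) → Bool) → (∀ y → side t s (toℕ y) ≡ g y) →
    Avoids t s ⇔ (∀ a c → π a ≡ π c → g a ≡ g c)
  avoids⇔invariant g side≗g = mk⇔
    (λ h a c e → trans (sym (side≗g a)) (trans (same-side h a c e) (side≗g c)))
    (λ h → avoids λ a c e → trans (side≗g a) (trans (h a c e) (sym (side≗g c))))

  invariant⇔singleton : ∀ x → (∀ a c → π a ≡ π c → eqF a x ≡ eqF c x) ⇔ isSingleton π x ≡ true
  invariant⇔singleton x = mk⇔
    (λ h → from (isSingleton⇔ π x) λ j e → does-true⁻¹ (j FinP.≟ x) (trans (h j x e) (eqF-refl x)))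
    (λ h a c e → bool-≡ (follows h e) (follows h (sym e)))
    where
    follows : isSingleton π x ≡ true → ∀ {a c} → π a ≡ π c → eqF a x ≡ true → eqF c x ≡ true
    follows h {a} {c} e a≟x =
      let a≡x = does-true⁻¹ (a FinP.≟ x) a≟x
          c≡x = to (isSingleton⇔ π x) h c (trans (sym e) (cong π a≡x))
      in subst (λ z → eqF z x ≡ true) (sym c≡x) (eqF-refl x)

  avoids-around⇔singleton : ∀ w → Avoids (toℕ w) (toℕ (cpred w)) ⇔ isSingleton π (cpred w) ≡ true
  avoids-around⇔singleton w with side-around w
  ... | inj₁ side≗eqF = ⇔-trans
          (avoids⇔invariant _ side≗eqF) (invariant⇔singleton (cpred w))
  ... | inj₂ side≗not = ⇔-trans
          (avoids⇔invariant _ side≗not)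
          (⇔-trans
            (mk⇔ (λ h a c e → not-injective (h a c e)) (λ h a c e → cong not (h a c e)))
            (invariant⇔singleton (cpred w)))

-- Blocks of a noncrossing partition

module Blocks {n : ℕ} (π : Part (suc n)) (nc : NonCrossing π) where
  open Chords π

  record Span (m M : Fin (suc n)) : Set where
    field
      same-block : π M ≡ π m
      least      : ∀ x → π x ≡ π m → toℕ m ≤ toℕ x
      greatest   : ∀ x → π x ≡ π m → toℕ x ≤ toℕ M
  open Span

  span-closed : ∀ {m M a c} → Span m M → π a ≡ π c → toℕ m ≤ toℕ a → toℕ a ≤ toℕ M →
    toℕ m ≤ toℕ c × toℕ c ≤ toℕ M
  span-closed {m} {M} {a} {c} sp πa≡πc m≤a a≤M with π a FinP.≟ π m
  ... | yes πa≡πm = least sp c (trans (sym πa≡πc) πa≡πm) , greatest sp c (trans (sym πa≡πc) πa≡πm)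
  ... | no  πa≢πm = ℕP.≮⇒≥ c≮m , ℕP.≮⇒≥ M≮c
    where
    m<a = ℕP.≤∧≢⇒< m≤a (λ e → πa≢πm (cong π (sym (FinP.toℕ-injective e))))
    a<M = ℕP.≤∧≢⇒< a≤M (λ e → πa≢πm (trans (cong π (FinP.toℕ-injective e)) (same-block sp)))
    c≮m : ¬ toℕ c < toℕ m
    c≮m c<m = πa≢πm (trans πa≡πc (nc c m a M c<m m<a a<M (sym πa≡πc) (sym (same-block sp))))
    M≮c : ¬ toℕ M < toℕ c
    M≮c M<c = πa≢πm (sym (nc m a M c m<a a<M M<c (sym (same-block sp)) πa≡πc))

  private
    inSpan : Fin (suc n) → Fin (suc n) → Fin (suc n) → Bool
    inSpan m M x = (toℕ m ≤ᵇ toℕ x) ∧ (toℕ x ≤ᵇ toℕ M)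

    inSpan-invariant : ∀ {m M} → Span m M → ∀ a c → π a ≡ π c → inSpan m M a ≡ inSpan m M c
    inSpan-invariant {m} {M} sp a c πa≡πc = bool-≡ (stays πa≡πc) (stays (sym πa≡πc))
      where
      stays : ∀ {a c} → π a ≡ π c → inSpan m M a ≡ true → inSpan m M c ≡ true
      stays {a} πa≡πc h =
        let (m≤c , c≤M) = span-closed sp πa≡πc (≤ᵇ-true⁻¹ (∧-conicalˡ _ (toℕ a ≤ᵇ toℕ M) h))
                                               (≤ᵇ-true⁻¹ (∧-conicalʳ (toℕ m ≤ᵇ toℕ a) _ h))
        in ∧-true (≤ᵇ-true m≤c) (≤ᵇ-true c≤M)

  avoids-span : ∀ {m M} → Span m M → Avoids (toℕ m) (suc (toℕ M))
  avoids-span {m} {M} sp = from (avoids⇔invariant {toℕ m} {suc (toℕ M)} (inSpan m M)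
    (λ y → side-span (toℕ y) (least sp M (same-block sp)))) (inSpan-invariant sp)

  avoids-span-to-0 : ∀ {m M} → Span m M → toℕ M ≡ n → Avoids (toℕ m) 0
  avoids-span-to-0 {m} {M} sp M≡n = from (avoids⇔invariant {toℕ m} {0} (not ∘ inSpan m M)
    (λ y → side-span-to-0 {toℕ m} (toℕ y) (subst (toℕ y ≤_) (sym M≡n) (ℕ.s≤s⁻¹ (FinP.toℕ<n y)))))
    (λ a c e → cong not (inSpan-invariant sp a c e))

  span-from-least : ∀ w → (∀ x → π x ≡ π w → toℕ w ≤ toℕ x) → Σ (Fin (suc n)) (Span w)
  span-from-least w w-least =
    let (M , πM≡πw , M-greatest) = greatest-witness (λ x → π x ≡ π w) (λ x → π x FinP.≟ π w) w refl
    in M , record { same-block = πM≡πw ; least = w-least ; greatest = M-greatest }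

  span-to-greatest : ∀ v → (∀ x → π x ≡ π v → toℕ x ≤ toℕ v) → Σ (Fin (suc n)) (λ m → Span m v)
  span-to-greatest v v-greatest =
    let (m , πm≡πv , m-least) = least-witness (λ x → π x ≡ π v) (λ x → π x FinP.≟ π v) v refl
    in m , record { same-block = sym πm≡πv
                  ; least      = λ x e → m-least x (trans e πm≡πv)
                  ; greatest   = λ x e → v-greatest x (trans e πm≡πv) }

  span-of-least : ∀ w → isLeast π w ≡ true → Σ (Fin (suc n)) (Span w)
  span-of-least w w-least =
    span-from-least w (λ x e → ℕP.≮⇒≥ λ x<w → to (isLeast⇔ π w) w-least x x<w e)

  joinable-past-span : ∀ {w M} → Span w M → toℕ M < n →
    ∃ λ u → toℕ w < toℕ u × Avoids (toℕ u) (toℕ w)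
  joinable-past-span {w} {M} sp M<n =
    fromℕ< (s≤s M<n) ,
    subst (toℕ w <_) (sym (FinP.toℕ-fromℕ< (s≤s M<n))) (s≤s (least sp M (same-block sp))) ,
    subst (λ t → Avoids t (toℕ w)) (sym (FinP.toℕ-fromℕ< (s≤s M<n))) (avoids-sym (avoids-span sp))

  joinable-past-block : ∀ {w M} → Span w M → (toℕ M ≡ n → w ≢ Fin.zero) →
    ∃ λ u → u ≢ w × Avoids (toℕ u) (toℕ w)
  joinable-past-block {w} {M} sp M≡n⇒w≢0 with toℕ M ℕ.≟ n
  ... | yes M≡n = Fin.zero , (λ 0≡w → M≡n⇒w≢0 M≡n (sym 0≡w)) , avoids-sym (avoids-span-to-0 sp M≡n)
  ... | no  M≢n =
    let (u , w<u , u~w) = joinable-past-span sp (ℕP.≤∧≢⇒< (ℕ.s≤s⁻¹ (FinP.toℕ<n M)) M≢n)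
    in u , (λ u≡w → ℕP.<-irrefl (cong toℕ (sym u≡w)) w<u) , u~w

  joinable-later : ∀ w → isLeast π w ≡ true → π w ≢ π (fromℕ n) →
    ∃ λ u → toℕ w < toℕ u × Avoids (toℕ u) (toℕ w)
  joinable-later w w-least πw≢πlast =
    let (M , sp) = span-of-least w w-least
    in joinable-past-span sp (ℕP.≤∧≢⇒< (ℕ.s≤s⁻¹ (FinP.toℕ<n M)) λ M≡n →
         πw≢πlast (trans (sym (same-block sp))
           (cong π (FinP.toℕ-injective (trans M≡n (sym (FinP.toℕ-fromℕ n)))))))

  -- By noncrossing, the block of cpred w cannot reach past w when a block
  -- element a < cpred w is joined to w.
  joinable-before-block : ∀ i {a} → toℕ a < suc (toℕ i) → π a ≡ π (Fin.suc i) →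
    π (cpred (Fin.suc i)) ≢ π (Fin.suc i) → ∃ λ u → u ≢ Fin.suc i × Avoids (toℕ u) (suc (toℕ i))
  joinable-before-block i {a} a<w πa≡πw πv≢πw =
    m , (λ m≡w → ℕP.<-irrefl (cong toℕ m≡w) m<w)
      , subst (Avoids (toℕ m)) (cong suc (FinP.toℕ-inject₁ i)) (avoids-span sp)
    where
    w = Fin.suc i
    v = cpred w
    v<w : toℕ v < toℕ w
    v<w = subst (_< toℕ w) (sym (FinP.toℕ-inject₁ i)) (ℕP.n<1+n (toℕ i))
    a<v : toℕ a < toℕ v
    a<v = ℕP.≤∧≢⇒< (subst (toℕ a ≤_) (sym (FinP.toℕ-inject₁ i)) (ℕ.s≤s⁻¹ a<w))
                   (λ e → πv≢πw (trans (sym (cong π (FinP.toℕ-injective e))) πa≡πw))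
    v-greatest : ∀ x → π x ≡ π v → toℕ x ≤ toℕ v
    v-greatest x πx≡πv = ℕP.≮⇒≥ λ v<x →
      let w<x = ℕP.≤∧≢⇒< (subst (_≤ toℕ x) (cong suc (FinP.toℕ-inject₁ i)) v<x)
                          (λ e → πv≢πw (trans (sym πx≡πv) (cong π (sym (FinP.toℕ-injective e)))))
      in πv≢πw (trans (sym (nc a v w x a<v v<w w<x πa≡πw (sym πx≡πv))) πa≡πw)
    m = proj₁ (span-to-greatest v v-greatest)
    sp = proj₂ (span-to-greatest v v-greatest)
    m<w = ℕP.≤-<-trans (least sp v (same-block sp)) v<w

  joinable-elsewhere : ∀ w → π (cpred w) ≢ π w → ∃ λ u → u ≢ w × Avoids (toℕ u) (toℕ w)
  joinable-elsewhere Fin.zero πlast≢π0 =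
    let (M , sp) = span-from-least Fin.zero (λ _ _ → z≤n)
    in joinable-past-block sp λ M≡n _ →
         πlast≢π0 (trans (cong π (FinP.toℕ-injective (trans (FinP.toℕ-fromℕ n) (sym M≡n))))
                         (same-block sp))
  joinable-elsewhere w@(Fin.suc i) πv≢πw with isLeast π w in eq
  ... | true  = joinable-past-block (proj₂ (span-of-least w eq)) (λ _ ())
  ... | false = let (a , a<w , πa≡πw) = isLeast-false π w eq
                in joinable-before-block i a<w πa≡πw πv≢πw

-- Duality between π and α(π)

countB-split-before : ∀ {n} (p r q : Fin (suc n) → Bool) →
  (∀ j → q j ≡ p (before j) ∧ not (r (before j))) →
  countB (λ i → p i ∧ r i) + countB q ≡ countB p
countB-split-before p r q q≗ = begin
  countB (λ i → p i ∧ r i) + countB q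
    ≡⟨ cong (countB (λ i → p i ∧ r i) +_)
         (trans (countB-cong q≗)
           (sym (countB-involution (λ i → p i ∧ not (r i)) before before-involutive))) ⟩
  countB (λ i → p i ∧ r i) + countB (λ i → p i ∧ not (r i))
    ≡⟨ countB-∧-split p r ⟩
  countB p ∎
  where open ≡-Reasoning

-- The interval family S′ used for α(π) is the mirror complement of S.
Complementary : ℕ → Fam → Fam → Set
Complementary n S S′ = ∀ (j : Fin (suc n)) →
  antiInS S′ j ≡ not (singletonInS S (before j)) × singletonInS S′ j ≡ not (antiInS S (before j))

gap-<⇒ : ∀ {n} {j j′ : Fin (suc n)} → gap j < gap j′ → toℕ j′ < toℕ j
gap-<⇒ {j = j} {j′} g<g′ = ℕP.≰⇒> λ j≤j′ → ℕP.<⇒≱ g<g′ (gap-antitone j≤j′)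

module Duality {n : ℕ} (π : Part (suc n)) (nc : NonCrossing π)
               (σ : Part (suc n)) (σ-isAlpha : IsAlpha π σ) where
  open Chords π
  open Blocks π nc

  same⇔avoids : ∀ x j → σ (opposite x) ≡ σ j ⇔ Avoids (toℕ x) (gap j)
  same⇔avoids x j = subst (λ t → σ (opposite x) ≡ σ j ⇔ Avoids t (gap j)) (gap-opposite x)
    (isAlpha⇒same⇔joinable σ-isAlpha (opposite x) j)

  antisingleton-dual : ∀ j → isAntisingleton σ j ≡ isSingleton π (before j)
  antisingleton-dual j = begin
    isAntisingleton σ j             ≡⟨ cong (isAntisingleton σ) (sym cpred-y≡j) ⟩
    isAntisingleton σ (cpred y)     ≡⟨ isAntisingleton-cpred σ y ⟩
    same σ (cpred y) y              ≡⟨ cong (λ k → same σ k y) cpred-y≡j ⟩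
    same σ j y                      ≡⟨ bool-≡ joined⇒lonely lonely⇒joined ⟩
    isSingleton π (before j)        ∎
    where
    open ≡-Reasoning
    y = opposite (before j)
    cpred-y≡j : cpred y ≡ j
    cpred-y≡j = before-involutive j
    joined⇒lonely : same σ j y ≡ true → isSingleton π (before j) ≡ true
    joined⇒lonely h = to (avoids-around⇔singleton (opposite j))
      (avoids-sym (to (same⇔avoids (before j) j) (sym (same-true⁻¹ σ h))))
    lonely⇒joined : isSingleton π (before j) ≡ true → same σ j y ≡ true
    lonely⇒joined h = same-true σ (sym (from (same⇔avoids (before j) j)
      (avoids-sym (from (avoids-around⇔singleton (opposite j)) h))))

  singleton-dual : ∀ j → isSingleton σ j ≡ isAntisingleton π (before j)
  singleton-dual j = trans (bool-≡ lonely⇒joined joined⇒lonely) (sym (isAntisingleton-cpred π w))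
    where
    w = opposite j
    lonely⇒joined : isSingleton σ j ≡ true → same π (cpred w) w ≡ true
    lonely⇒joined h with π (cpred w) FinP.≟ π w
    ... | yes _ = refl
    ... | no  πv≢πw =
      let (u , u≢w , u~w) = joinable-elsewhere w πv≢πw
          u′≡j = to (isSingleton⇔ σ j) h (opposite u) (from (same⇔avoids u j) u~w)
      in contradiction (trans (sym (FinP.opposite-involutive u)) (cong opposite u′≡j)) u≢w
    joined⇒lonely : same π (cpred w) w ≡ true → isSingleton σ j ≡ true
    joined⇒lonely h = from (isSingleton⇔ σ j) λ j′ σj′≡σj →
      gap-injective (decidable-stable (gap j′ ℕ.≟ gap j) λ g′≢g →
        side-separates-neighbours (gap j′) w (gap≤n j′) g′≢g
          (same-side (to (isAlpha⇒same⇔joinable σ-isAlpha j′ j) σj′≡σj) (cpred w) w (same-true⁻¹ π h)))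

  least-dual : ∀ j → isLeast σ j ≡ not (isLeast π (opposite j)) ∨ same π (opposite j) (fromℕ n)
  least-dual j = bool-≡ least⇒ ⇒least
    where
    w = opposite j
    last = fromℕ n
    least⇒ : isLeast σ j ≡ true → not (isLeast π w) ∨ same π w last ≡ true
    least⇒ h with isLeast π w in eq
    ... | false = refl
    ... | true with π w FinP.≟ π last
    ...   | yes _ = refl
    ...   | no  πw≢πlast =
      let (u , w<u , u~w) = joinable-later w eq πw≢πlast
      in contradiction (from (same⇔avoids u j) u~w)
           (to (isLeast⇔ σ j) h (opposite u) (gap-<⇒ (subst (toℕ w <_) (sym (gap-opposite u)) w<u)))
    blocked : not (isLeast π w) ≡ true ⊎ same π w last ≡ true →
      ∀ {t} → gap j < t → t ≤ n → ¬ Avoids t (gap j)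
    blocked (inj₁ not-least) g<t _ chord =
      let (a , a<w , πa≡πw) = isLeast-false π w (not-injective not-least)
      in contradiction (trans (sym (side-both-> (ℕP.<-trans a<w g<t) a<w))
                         (trans (same-side chord a w πa≡πw) (side-inside ℕP.≤-refl g<t))) λ ()
    blocked (inj₂ w~last) {t} g<t t≤n chord =
      contradiction (trans (sym (side-inside ℕP.≤-refl g<t))
        (trans (same-side chord w last (same-true⁻¹ π w~last))
          (side-both-≤ (subst (t ≤_) (sym (FinP.toℕ-fromℕ n)) t≤n)
                       (subst (gap j ≤_) (sym (FinP.toℕ-fromℕ n)) (gap≤n j))))) λ ()
    ⇒least : not (isLeast π w) ∨ same π w last ≡ true → isLeast σ j ≡ true
    ⇒least h = from (isLeast⇔ σ j) λ j′ j′<j σj′≡σj →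
      blocked (∨-true⁻¹ h) (gap-strictly-antitone j′<j) (gap≤n j′)
        (to (isAlpha⇒same⇔joinable σ-isAlpha j′ j) σj′≡σj)

  blocks-dual : countB (isLeast π) + countB (isLeast σ) ≡ suc (suc n)
  blocks-dual = begin
    countB (isLeast π) + countB (isLeast σ)
      ≡⟨ cong (countB (isLeast π) +_) (trans (countB-cong least-dual)
           (sym (countB-involution p opposite FinP.opposite-involutive))) ⟩
    countB (isLeast π) + countB p
      ≡⟨ countB-∨-not (isLeast π) (λ w → same π w last) ⟩
    suc n + countB (λ w → isLeast π w ∧ same π w last)
      ≡⟨ cong (suc n +_) (trans (countB-cong (proj₂ (least-in-block π last)))
                                (countB-eqF (proj₁ (least-in-block π last)))) ⟩
    suc n + 1
      ≡⟨ ℕP.+-comm (suc n) 1 ⟩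
    suc (suc n) ∎
    where
    open ≡-Reasoning
    last = fromℕ n
    p : Fin (suc n) → Bool
    p w = not (isLeast π w) ∨ same π w last

  wtExp-dual : ∀ {S S′} → Complementary n S S′ → wtExp S π + wtExp S′ σ ≡ suc (suc n)
  wtExp-dual {S} {S′} complementary = begin
    wtExp S π + wtExp S′ σ
      ≡⟨ regroup (block π) sπ aπ (block σ) sσ aσ ⟩
    (block π + (sπ + aσ)) + (block σ + (aπ + sσ))
      ≡⟨ cong₂ (λ x y → (block π + x) + (block σ + y)) singletons antisingletons ⟩
    (block π + countB (isSingleton π)) + (block σ + countB (isSingleton σ))
      ≡⟨ cong₂ _+_ (block+singletons π) (block+singletons σ) ⟩
    countB (isLeast π) + countB (isLeast σ)
      ≡⟨ blocks-dual ⟩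
    suc (suc n) ∎
    where
    open ≡-Reasoning
    sπ = countB (λ i → isSingleton π i ∧ singletonInS S i)
    aπ = countB (λ i → isAntisingleton π i ∧ antiInS S i)
    sσ = countB (λ i → isSingleton σ i ∧ singletonInS S′ i)
    aσ = countB (λ i → isAntisingleton σ i ∧ antiInS S′ i)
    regroup : ∀ b s a b′ s′ a′ → (b + s + a) + (b′ + s′ + a′) ≡ (b + (s + a′)) + (b′ + (a + s′))
    regroup = solve-∀
    singletons : sπ + aσ ≡ countB (isSingleton π)
    singletons = countB-split-before (isSingleton π) (singletonInS S) _
      λ j → cong₂ _∧_ (antisingleton-dual j) (proj₁ (complementary j))
    antisingletons : aπ + sσ ≡ countB (isSingleton σ)
    antisingletons = begin
      aπ + sσ
        ≡⟨ countB-split-before (isAntisingleton π) (antiInS S) _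
             (λ j → cong₂ _∧_ (singleton-dual j) (proj₂ (complementary j))) ⟩
      countB (isAntisingleton π)
        ≡⟨ countB-involution (isAntisingleton π) before before-involutive ⟩
      countB (isAntisingleton π ∘ before)
        ≡⟨ countB-cong singleton-dual ⟨
      countB (isSingleton σ) ∎

antiInS-none : ∀ {d} (i : Fin d) → antiInS none i ≡ false
antiInS-none {d} i with suc (toℕ i) ≡ᵇ d
... | true  = refl
... | false = refl

antiInS-whole* : ∀ {d} (i : Fin d) → antiInS whole* i ≡ true
antiInS-whole* {d} i with suc (toℕ i) ≡ᵇ d
... | true  = refl
... | false = refl

antiInS-last : ∀ {n} k l (i : Fin (suc n)) → toℕ i ≡ n → antiInS (iv k l) i ≡ false
antiInS-last {n} k l i i≡n with suc (toℕ i) ≡ᵇ suc n in eq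
... | true  = refl
... | false = contradiction (trans (sym eq) (≡ᵇ-true (cong suc i≡n))) λ ()

antiInS-suffix : ∀ {n} k (i : Fin (suc n)) → toℕ i < n → antiInS (iv (suc k) (suc n)) i ≡ (k ≤ᵇ toℕ i)
antiInS-suffix {n} k i i<n with suc (toℕ i) ≡ᵇ suc n in eq
... | true  = contradiction (ℕP.suc-injective (≡ᵇ-true⁻¹ {suc (toℕ i)} eq)) (ℕP.<⇒≢ i<n)
... | false rewrite ≤ᵇ-suc k (toℕ i) | ≤ᵇ-true {suc (suc (toℕ i))} {suc n} (s≤s i<n) =
  ∧-identityʳ (k ≤ᵇ toℕ i)

singletonInS-suffix : ∀ {n} k (i : Fin (suc n)) → singletonInS (iv (suc k) (suc n)) i ≡ (k ≤ᵇ toℕ i)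
singletonInS-suffix k i rewrite ≤ᵇ-suc k (toℕ i) | ≤ᵇ-true (FinP.toℕ<n i) = ∧-identityʳ (k ≤ᵇ toℕ i)

≤ᵇ-mirror : ∀ {n k} x → x < n → k ≤ n → (n ∸ k ≤ᵇ x) ≡ not (k ≤ᵇ n ∸ suc x)
≤ᵇ-mirror {n} {k} x x<n k≤n with ℕP.≤-<-connex k (n ∸ suc x)
... | inj₁ k≤n-1-x rewrite ≤ᵇ-true k≤n-1-x =
  ≤ᵇ-false (subst (_≤ n ∸ k) (ℕP.m∸[m∸n]≡n x<n) (ℕP.∸-monoʳ-≤ n k≤n-1-x))
... | inj₂ n-1-x<k rewrite ≤ᵇ-false n-1-x<k =
  ≤ᵇ-true (ℕ.s≤s⁻¹ (subst (n ∸ k <_) (ℕP.m∸[m∸n]≡n x<n) (ℕP.∸-monoʳ-< n-1-x<k k≤n)))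

suffix-complementary : ∀ {n k} → k ≤ n →
  Complementary n (iv (suc k) (suc n)) (iv (suc (n ∸ k)) (suc n))
suffix-complementary {n} {k} k≤n j with before-cases j
... | inj₁ (j≡n , before≡n)
  rewrite antiInS-last (suc (n ∸ k)) (suc n) j j≡n | antiInS-last (suc k) (suc n) (before j) before≡n
        | singletonInS-suffix k (before j) | before≡n | ≤ᵇ-true k≤n
        | singletonInS-suffix (n ∸ k) j | j≡n | ≤ᵇ-true (ℕP.m∸n≤m n k) = refl , refl
... | inj₂ (j<n , before≡)
  rewrite antiInS-suffix (n ∸ k) j j<n | singletonInS-suffix k (before j)
        | singletonInS-suffix (n ∸ k) j
        | antiInS-suffix k (before j) (subst (_< n) (sym before≡) (ℕP.∸-monoʳ-< (s≤s z≤n) j<n))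
        | before≡ = ≤ᵇ-mirror (toℕ j) j<n k≤n , ≤ᵇ-mirror (toℕ j) j<n k≤n

famIdx-complementary : ∀ {n} k → k ≤ suc (suc n) →
  Complementary n (famIdx (suc n) k) (famIdx (suc n) (suc (suc n) ∸ k))
famIdx-complementary {n} zero _
  rewrite ≤ᵇ-false {suc (suc n)} {suc n} (ℕP.n<1+n (suc n)) =
  λ j → antiInS-none j , cong not (sym (antiInS-whole* (before j)))
famIdx-complementary {n} (suc k) 1+k≤2+n with ℕP.m≤n⇒m<n∨m≡n (ℕ.s≤s⁻¹ 1+k≤2+n)
... | inj₂ refl rewrite ≤ᵇ-false {suc (suc n)} {suc n} (ℕP.n<1+n (suc n)) | ℕP.n∸n≡0 n =
  λ j → antiInS-whole* j , cong not (sym (antiInS-none (before j)))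
... | inj₁ k<1+n
  rewrite ≤ᵇ-true {suc k} {suc n} k<1+n
        | ℕP.+-∸-assoc 1 (ℕ.s≤s⁻¹ k<1+n)
        | ≤ᵇ-true {suc (n ∸ k)} {suc n} (s≤s (ℕP.m∸n≤m n k)) =
  suffix-complementary (ℕ.s≤s⁻¹ k<1+n)

lemma5p3 : (d : ℕ) → 1 ≤ d → (π : Part d) → NonCrossing π →
    (k : ℕ) → k ≤ suc d →
    Σ (Part d) (λ σ → IsAlpha π σ) ×
    ((σ : Part d) → IsAlpha π σ → wtkExp k π + wtkExp (suc d ∸ k) σ ≡ suc d)
lemma5p3 (suc n) _ π nc k k≤ =
  (Chords.alpha π , Chords.alpha-isAlpha π) ,
  λ σ σ-isAlpha → Duality.wtExp-dual π nc σ σ-isAlpha (famIdx-complementary k k≤)
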